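{- Let $\langle\mathbf{A}_{\mathrm d},\mathbf{A},\iota\rangle$ be a (generalized) additive quantale with multiplication, let $\mathbf{P}$ and $\mathbf{Q}$ be projective $\mathbf{A}$-modules, and let $\gamma$ and $\delta$ be structural nuclei on $\mathbf{P}$ and $\mathbf{Q}$ respectively. Then every isomorphism of modules given by mutually inverse maps $f\colon\mathbf{P}_\gamma\to\mathbf{Q}_\delta$ and $g\colon\mathbf{Q}_\delta\to\mathbf{P}_\gamma$ is induced by a pair of module homomorphisms $\tau\colon\mathbf{P}\to\mathbf{Q}$ and $\rho\colon\mathbf{Q}\to\mathbf{P}$ in the sense that $f\circ\gamma=\delta\circ\tau$ and $g\circ\delta=\gamma\circ\rho$.
   Context: Fix one of two parallel settings: plain ("joins" = joins of arbitrary families) or generalized ("joins" = joins of non-empty families). A (generalized) quantale is $\langle Q,\bigvee,+,\mathsf{0}\rangle$ with $Q$ a poset having all such joins, $\langle Q,+,\mathsf{0}\rangle$ a monoid with $+$ order-preserving and distributing over such joins on both sides. A (generalized) additive quantale with multiplication is a triple $\langle\mathbf{A}_{\mathrm d},\mathbf{A},\iota\rangle$: $\mathbf{A}_{\mathrm d}$ a monoid, $\mathbf{A}$ a (generalized) quantale with an additional monoid structure $\langle A,\cdot,\mathsf 1\rangle$, $\iota$ a monoid homomorphism, such that $(\bigvee_i a_i)\cdot b=\bigvee_i(a_i\cdot b)$, $(a+b)\cdot c=a\cdot c+b\cdot c$, $\mathsf0\cdot a=\mathsf0$, and for $d\in\mathbf{A}_{\mathrm d}$ left multiplication by $\iota(d)$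 preserves joins, $+$, $\mathsf0$. An $\mathbf{A}$-module is a (generalized) quantale $\mathbf{Q}$ with $\ast\colon A\times Q\to Q$, order-preserving in both coordinates, with $(a\cdot b)\ast x=a\ast(b\ast x)$, $\mathsf1\ast x=x$, $(a+b)\ast x=a\ast x+b\ast x$, $\mathsf0\ast x=\mathsf0$, $(\bigvee_i a_i)\ast x=\bigvee_i(a_i\ast x)$, and $x\mapsto\iota(d)\ast x$ preserving $+$, $\mathsf0$, joins for $d\in\mathbf{A}_{\mathrm d}$; module homomorphisms are quantale homomorphisms $f$ with $f(a\ast x)=a\ast f(x)$. A module $\mathbf{P}$ is projective if for every surjective module homomorphism $g\colon\mathbf{R}\to\mathbf{S}$ and module homomorphism $h\colon\mathbf{P}\to\mathbf{S}$ there is a module homomorphism $h'\colon\mathbf{P}\to\mathbf{R}$ with $g\circ h'=h$. A structural nucleus on a module $\mathbf{Q}$ is an order-preserving, expansive, idempotent map $\gamma$ with $\gamma(x)+\gamma(y)\le\gamma(x+y)$ and $a\ast\gamma(x)\le\gamma(a\ast x)$ for all $a$; $\mathbf{Q}_\gamma$ is the module on $\gamma[Q]$ with $\bigvee_\gamma X=\gamma(\bigvee X)$, $x+_\gamma y=\gamma(x+y)$, $\mathsf0_\gamma=\gamma(\mathsf0)$, $a\ast_\gamma x=\gamma(a\ast x)$. -}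

module Defs where

open import Level using (Level; _⊔_; Setω) renaming (suc to lsuc)
open import Data.Unit.Polymorphic using (⊤)
open import Data.Product using (Σ; _,_; proj₁; proj₂; Σ-syntax)
open import Function using (_∘_)
open import Relation.Binary.PropositionalEquality
open import Algebra.Structures using (IsMonoid)
open import Axiom.UniquenessOfIdentityProofs.WithK using (uip)

-- The two parallel settings.
--   plain       : joins of arbitrary families (indexed by any I : Set i)
--   generalized : joins of non-empty families (an element of I is given)

data Setting : Set where
  plain generalized : Setting

Admissible : ∀ {i} → Setting → Set i → Set i
Admissible plain       I = ⊤
Admissible generalized I = I

record Quantale (s : Setting) (c ℓ i : Level) : Set (lsuc (c ⊔ ℓ ⊔ i)) where
  infixl 6 _+_
  infix 4 _≤_
  field
    Carrier   : Set c
    _≤_       : Carrier → Carrier → Set ℓ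
    ≤-refl    : ∀ {x} → x ≤ x
    ≤-trans   : ∀ {x y z} → x ≤ y → y ≤ z → x ≤ z
    ≤-antisym : ∀ {x y} → x ≤ y → y ≤ x → x ≡ y
    ⋁         : {I : Set i} → Admissible s I → (I → Carrier) → Carrier
    ⋁-ub      : ∀ {I : Set i} (ne : Admissible s I) (a : I → Carrier) (k : I) →
                a k ≤ ⋁ ne a
    ⋁-least   : ∀ {I : Set i} (ne : Admissible s I) (a : I → Carrier) (b : Carrier) →
                (∀ k → a k ≤ b) → ⋁ ne a ≤ b
    _+_       : Carrier → Carrier → Carrier
    𝟘         : Carrier
    +-assoc     : ∀ x y z → (x + y) + z ≡ x + (y + z)
    +-identityˡ : ∀ x → 𝟘 + x ≡ x
    +-identityʳ : ∀ x → x + 𝟘 ≡ x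
    +-mono      : ∀ {x x′ y y′} → x ≤ x′ → y ≤ y′ → x + y ≤ x′ + y′
    +-distribʳ-⋁ : ∀ {I : Set i} (ne : Admissible s I) (a : I → Carrier) (b : Carrier) →
                   ⋁ ne a + b ≡ ⋁ ne (λ k → a k + b)
    +-distribˡ-⋁ : ∀ {I : Set i} (ne : Admissible s I) (a : I → Carrier) (b : Carrier) →
                   b + ⋁ ne a ≡ ⋁ ne (λ k → b + a k)

record AQM (s : Setting) (d c ℓ i : Level) : Set (lsuc (d ⊔ c ⊔ ℓ ⊔ i)) where
  infixl 7 _·_
  field
    D          : Set d
    _∙_        : D → D → D
    ε          : D
    D-isMonoid : IsMonoid _≡_ _∙_ ε
    𝐀          : Quantale s c ℓ i
  open Quantale 𝐀
  field
    _·_        : Carrier → Carrier → Carrier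
    𝟙          : Carrier
    ·-isMonoid : IsMonoid _≡_ _·_ 𝟙
    ι          : D → Carrier
    ι-∙        : ∀ d e → ι (d ∙ e) ≡ ι d · ι e
    ι-ε        : ι ε ≡ 𝟙
    ·-distribʳ-⋁ : ∀ {I : Set i} (ne : Admissible s I) (a : I → Carrier) (b : Carrier) →
                   ⋁ ne a · b ≡ ⋁ ne (λ k → a k · b)
    ·-distribʳ-+ : ∀ a b c → (a + b) · c ≡ a · c + b · c
    𝟘-·          : ∀ a → 𝟘 · a ≡ 𝟘
    ι-·-⋁        : ∀ (e : D) {I : Set i} (ne : Admissible s I) (a : I → Carrier) →
                   ι e · ⋁ ne a ≡ ⋁ ne (λ k → ι e · a k)
    ι-·-+        : ∀ (e : D) a b → ι e · (a + b) ≡ ι e · a + ι e · b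
    ι-·-𝟘        : ∀ (e : D) → ι e · 𝟘 ≡ 𝟘

record Module {s : Setting} {d c ℓ i : Level} (𝔸 : AQM s d c ℓ i) (c′ ℓ′ : Level)
       : Set (lsuc (d ⊔ c ⊔ ℓ ⊔ i ⊔ c′ ⊔ ℓ′)) where
  private
    module A = Quantale (AQM.𝐀 𝔸)
  open AQM 𝔸 using (D; ι; _·_; 𝟙)
  infixr 7 _∗_
  field
    𝐐   : Quantale s c′ ℓ′ i
  open Quantale 𝐐
  field
    _∗_   : A.Carrier → Carrier → Carrier
    ∗-mono  : ∀ {a a′ x x′} → a A.≤ a′ → x ≤ x′ → a ∗ x ≤ a′ ∗ x′
    ∗-assoc : ∀ a b x → (a · b) ∗ x ≡ a ∗ (b ∗ x)
    𝟙-∗     : ∀ x → 𝟙 ∗ x ≡ x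
    +-∗     : ∀ a b x → (a A.+ b) ∗ x ≡ a ∗ x + b ∗ x
    𝟘-∗     : ∀ x → A.𝟘 ∗ x ≡ 𝟘
    ⋁-∗     : ∀ {I : Set i} (ne : Admissible s I) (a : I → A.Carrier) (x : Carrier) →
              A.⋁ ne a ∗ x ≡ ⋁ ne (λ k → a k ∗ x)
    ι-∗-+   : ∀ (e : D) x y → ι e ∗ (x + y) ≡ ι e ∗ x + ι e ∗ y
    ι-∗-𝟘   : ∀ (e : D) → ι e ∗ 𝟘 ≡ 𝟘
    ι-∗-⋁   : ∀ (e : D) {I : Set i} (ne : Admissible s I) (x : I → Carrier) →
              ι e ∗ ⋁ ne x ≡ ⋁ ne (λ k → ι e ∗ x k)

record Hom {s d c ℓ i c₁ ℓ₁ c₂ ℓ₂} {𝔸 : AQM s d c ℓ i}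
           (M : Module 𝔸 c₁ ℓ₁) (N : Module 𝔸 c₂ ℓ₂)
           : Set (c ⊔ lsuc i ⊔ c₁ ⊔ c₂) where
  private
    module A = Quantale (AQM.𝐀 𝔸)
    module M = Quantale (Module.𝐐 M)
    module N = Quantale (Module.𝐐 N)
  field
    fun    : M.Carrier → N.Carrier
    pres-⋁ : ∀ {I : Set i} (ne : Admissible s I) (x : I → M.Carrier) →
             fun (M.⋁ ne x) ≡ N.⋁ ne (fun ∘ x)
    pres-+ : ∀ x y → fun (x M.+ y) ≡ fun x N.+ fun y
    pres-𝟘 : fun M.𝟘 ≡ N.𝟘
    pres-∗ : ∀ (a : A.Carrier) x → fun (Module._∗_ M a x) ≡ Module._∗_ N a (fun x)

open Hom public using (fun)

Surjective : ∀ {s d c ℓ i c₁ ℓ₁ c₂ ℓ₂} {𝔸 : AQM s d c ℓ i}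
             {M : Module 𝔸 c₁ ℓ₁} {N : Module 𝔸 c₂ ℓ₂} → Hom M N → Set (c₁ ⊔ c₂)
Surjective {M = M} {N = N} h =
  ∀ (y : Quantale.Carrier (Module.𝐐 N)) → Σ[ x ∈ Quantale.Carrier (Module.𝐐 M) ] fun h x ≡ y

Projective : ∀ {s d c ℓ i c₁ ℓ₁} {𝔸 : AQM s d c ℓ i} → Module 𝔸 c₁ ℓ₁ → Setω
Projective {𝔸 = 𝔸} P =
  ∀ {c₂ ℓ₂ c₃ ℓ₃} (R : Module 𝔸 c₂ ℓ₂) (S : Module 𝔸 c₃ ℓ₃)
    (g : Hom R S) → Surjective g → (h : Hom P S) →
    Σ[ h′ ∈ Hom P R ] (∀ x → fun g (fun h′ x) ≡ fun h x)

record StructuralNucleus {s d c ℓ i c₁ ℓ₁} {𝔸 : AQM s d c ℓ i}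
                         (M : Module 𝔸 c₁ ℓ₁) : Set (c ⊔ c₁ ⊔ ℓ₁) where
  private
    module A = Quantale (AQM.𝐀 𝔸)
  open Quantale (Module.𝐐 M)
  open Module M using (_∗_)
  field
    γ          : Carrier → Carrier
    mono       : ∀ {x y} → x ≤ y → γ x ≤ γ y
    expansive  : ∀ x → x ≤ γ x
    idempotent : ∀ x → γ (γ x) ≡ γ x
    +-sub      : ∀ x y → γ x + γ y ≤ γ (x + y)
    ∗-sub      : ∀ (a : A.Carrier) x → a ∗ γ x ≤ γ (a ∗ x)

-- The module M_γ on the image γ[M] (= the fixed points of γ), with
--   ⋁_γ X = γ(⋁ X),  x +_γ y = γ(x + y),  𝟘_γ = γ 𝟘,  a ∗_γ x = γ(a ∗ x).

module NucleusQuotient {s d c ℓ i c₁ ℓ₁} {𝔸 : AQM s d c ℓ i}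
                       (M : Module 𝔸 c₁ ℓ₁) (N : StructuralNucleus M) where
  private
    module A = Quantale (AQM.𝐀 𝔸)
  open AQM 𝔸 using (ι; _·_; 𝟙)
  open Quantale (Module.𝐐 M)
  open Module M
  open StructuralNucleus N

  Fix : Set c₁
  Fix = Σ[ x ∈ Carrier ] γ x ≡ x

  ⌊_⌋ : Carrier → Fix
  ⌊ x ⌋ = γ x , idempotent x

  private
    open ≡-Reasoning

    fix≡ : ∀ {p q : Fix} → proj₁ p ≡ proj₁ q → p ≡ q
    fix≡ {x , p} {.x , q} refl = cong (x ,_) (uip p q)

    ≤-reflexive : ∀ {u v} → u ≡ v → u ≤ v
    ≤-reflexive refl = ≤-refl

    γ-≤ : ∀ {x y} → x ≤ γ y → γ x ≤ γ y
    γ-≤ {x} {y} p = ≤-trans (mono p) (≤-reflexive (idempotent y))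

    γ-+ : ∀ x y → γ (γ x + γ y) ≡ γ (x + y)
    γ-+ x y = ≤-antisym (γ-≤ (+-sub x y))
                        (mono (+-mono (expansive x) (expansive y)))

    γ-⋁ : ∀ {I : Set i} (ne : Admissible s I) (y : I → Carrier) →
          γ (⋁ ne (γ ∘ y)) ≡ γ (⋁ ne y)
    γ-⋁ ne y = ≤-antisym
      (γ-≤ (⋁-least ne (γ ∘ y) _ (λ k → mono (⋁-ub ne y k))))
      (mono (⋁-least ne y _ (λ k → ≤-trans (expansive (y k)) (⋁-ub ne (γ ∘ y) k))))

    γ-∗ : ∀ a y → γ (a ∗ γ y) ≡ γ (a ∗ y)
    γ-∗ a y = ≤-antisym (γ-≤ (∗-sub a y)) (mono (∗-mono A.≤-refl (expansive y)))

    _+γ_ : Fix → Fix → Fix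
    p +γ q = ⌊ proj₁ p + proj₁ q ⌋

    γ-+ˡ : ∀ x y z → γ z ≡ z → γ (γ (x + y) + z) ≡ γ ((x + y) + z)
    γ-+ˡ x y z fz = begin
      γ (γ (x + y) + z)     ≡⟨ cong (λ w → γ (γ (x + y) + w)) (sym fz) ⟩
      γ (γ (x + y) + γ z)   ≡⟨ γ-+ (x + y) z ⟩
      γ ((x + y) + z)       ∎

    γ-+ʳ : ∀ x y z → γ x ≡ x → γ (x + γ (y + z)) ≡ γ (x + (y + z))
    γ-+ʳ x y z fx = begin
      γ (x + γ (y + z))     ≡⟨ cong (λ w → γ (w + γ (y + z))) (sym fx) ⟩
      γ (γ x + γ (y + z))   ≡⟨ γ-+ x (y + z) ⟩
      γ (x + (y + z))       ∎

  Quantaleγ : Quantale s c₁ ℓ₁ i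
  Quantaleγ = record
    { Carrier   = Fix
    ; _≤_       = λ p q → proj₁ p ≤ proj₁ q
    ; ≤-refl    = ≤-refl
    ; ≤-trans   = ≤-trans
    ; ≤-antisym = λ p q → fix≡ (≤-antisym p q)
    ; ⋁         = λ ne a → ⌊ ⋁ ne (proj₁ ∘ a) ⌋
    ; ⋁-ub      = λ ne a k → ≤-trans (⋁-ub ne (proj₁ ∘ a) k) (expansive _)
    ; ⋁-least   = λ ne a b h →
        ≤-trans (mono (⋁-least ne (proj₁ ∘ a) (proj₁ b) h)) (≤-reflexive (proj₂ b))
    ; _+_       = _+γ_
    ; 𝟘         = ⌊ 𝟘 ⌋
    ; +-assoc   = λ { (x , fx) (y , fy) (z , fz) → fix≡ (begin
        γ (γ (x + y) + z)   ≡⟨ γ-+ˡ x y z fz ⟩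
        γ ((x + y) + z)     ≡⟨ cong γ (+-assoc x y z) ⟩
        γ (x + (y + z))     ≡⟨ sym (γ-+ʳ x y z fx) ⟩
        γ (x + γ (y + z))   ∎) }
    ; +-identityˡ = λ { (x , fx) → fix≡ (begin
        γ (γ 𝟘 + x)     ≡⟨ cong (λ w → γ (γ 𝟘 + w)) (sym fx) ⟩
        γ (γ 𝟘 + γ x)   ≡⟨ γ-+ 𝟘 x ⟩
        γ (𝟘 + x)       ≡⟨ cong γ (+-identityˡ x) ⟩
        γ x             ≡⟨ fx ⟩
        x               ∎) }
    ; +-identityʳ = λ { (x , fx) → fix≡ (begin
        γ (x + γ 𝟘)     ≡⟨ cong (λ w → γ (w + γ 𝟘)) (sym fx) ⟩
        γ (γ x + γ 𝟘)   ≡⟨ γ-+ x 𝟘 ⟩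
        γ (x + 𝟘)       ≡⟨ cong γ (+-identityʳ x) ⟩
        γ x             ≡⟨ fx ⟩
        x               ∎) }
    ; +-mono    = λ p q → mono (+-mono p q)
    ; +-distribʳ-⋁ = λ ne a b → fix≡ (begin
        γ (γ (⋁ ne (proj₁ ∘ a)) + proj₁ b)
          ≡⟨ cong (λ w → γ (γ (⋁ ne (proj₁ ∘ a)) + w)) (sym (proj₂ b)) ⟩
        γ (γ (⋁ ne (proj₁ ∘ a)) + γ (proj₁ b))
          ≡⟨ γ-+ _ _ ⟩
        γ (⋁ ne (proj₁ ∘ a) + proj₁ b)
          ≡⟨ cong γ (+-distribʳ-⋁ ne (proj₁ ∘ a) (proj₁ b)) ⟩
        γ (⋁ ne (λ k → proj₁ (a k) + proj₁ b))
          ≡⟨ sym (γ-⋁ ne _) ⟩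
        γ (⋁ ne (λ k → γ (proj₁ (a k) + proj₁ b)))   ∎)
    ; +-distribˡ-⋁ = λ ne a b → fix≡ (begin
        γ (proj₁ b + γ (⋁ ne (proj₁ ∘ a)))
          ≡⟨ cong (λ w → γ (w + γ (⋁ ne (proj₁ ∘ a)))) (sym (proj₂ b)) ⟩
        γ (γ (proj₁ b) + γ (⋁ ne (proj₁ ∘ a)))
          ≡⟨ γ-+ _ _ ⟩
        γ (proj₁ b + ⋁ ne (proj₁ ∘ a))
          ≡⟨ cong γ (+-distribˡ-⋁ ne (proj₁ ∘ a) (proj₁ b)) ⟩
        γ (⋁ ne (λ k → proj₁ b + proj₁ (a k)))
          ≡⟨ sym (γ-⋁ ne _) ⟩
        γ (⋁ ne (λ k → γ (proj₁ b + proj₁ (a k))))   ∎)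
    }

  Moduleγ : Module 𝔸 c₁ ℓ₁
  Moduleγ = record
    { 𝐐       = Quantaleγ
    ; _∗_     = λ a p → ⌊ a ∗ proj₁ p ⌋
    ; ∗-mono  = λ p q → mono (∗-mono p q)
    ; ∗-assoc = λ a b p → fix≡ (begin
        γ ((a · b) ∗ proj₁ p)     ≡⟨ cong γ (∗-assoc a b (proj₁ p)) ⟩
        γ (a ∗ (b ∗ proj₁ p))     ≡⟨ sym (γ-∗ a _) ⟩
        γ (a ∗ γ (b ∗ proj₁ p))   ∎)
    ; 𝟙-∗     = λ p → fix≡ (trans (cong γ (𝟙-∗ (proj₁ p))) (proj₂ p))
    ; +-∗     = λ a b p → fix≡ (begin
        γ ((a A.+ b) ∗ proj₁ p)               ≡⟨ cong γ (+-∗ a b (proj₁ p)) ⟩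
        γ (a ∗ proj₁ p + b ∗ proj₁ p)         ≡⟨ sym (γ-+ _ _) ⟩
        γ (γ (a ∗ proj₁ p) + γ (b ∗ proj₁ p)) ∎)
    ; 𝟘-∗     = λ p → fix≡ (cong γ (𝟘-∗ (proj₁ p)))
    ; ⋁-∗     = λ ne a p → fix≡ (begin
        γ (A.⋁ ne a ∗ proj₁ p)                   ≡⟨ cong γ (⋁-∗ ne a (proj₁ p)) ⟩
        γ (⋁ ne (λ k → a k ∗ proj₁ p))           ≡⟨ sym (γ-⋁ ne _) ⟩
        γ (⋁ ne (λ k → γ (a k ∗ proj₁ p)))       ∎)
    ; ι-∗-+   = λ e p q → fix≡ (begin
        γ (ι e ∗ γ (proj₁ p + proj₁ q))             ≡⟨ γ-∗ (ι e) _ ⟩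
        γ (ι e ∗ (proj₁ p + proj₁ q))               ≡⟨ cong γ (ι-∗-+ e _ _) ⟩
        γ (ι e ∗ proj₁ p + ι e ∗ proj₁ q)           ≡⟨ sym (γ-+ _ _) ⟩
        γ (γ (ι e ∗ proj₁ p) + γ (ι e ∗ proj₁ q))   ∎)
    ; ι-∗-𝟘   = λ e → fix≡ (begin
        γ (ι e ∗ γ 𝟘)   ≡⟨ γ-∗ (ι e) 𝟘 ⟩
        γ (ι e ∗ 𝟘)     ≡⟨ cong γ (ι-∗-𝟘 e) ⟩
        γ 𝟘             ∎)
    ; ι-∗-⋁   = λ e ne x → fix≡ (begin
        γ (ι e ∗ γ (⋁ ne (proj₁ ∘ x)))           ≡⟨ γ-∗ (ι e) _ ⟩
        γ (ι e ∗ ⋁ ne (proj₁ ∘ x))               ≡⟨ cong γ (ι-∗-⋁ e ne _) ⟩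
        γ (⋁ ne (λ k → ι e ∗ proj₁ (x k)))       ≡⟨ sym (γ-⋁ ne _) ⟩
        γ (⋁ ne (λ k → γ (ι e ∗ proj₁ (x k))))   ∎)
    }

-- The quotient map x ↦ γ x is a surjective module homomorphism P → P_γ.
-- Projectivity of P lifts f ∘ ⌊_⌋ : P → Q_δ along the surjection Q → Q_δ to
-- some τ : P → Q, and symmetrically for g.
module Submission where

open import Defs
open import Level using (Level)
open import Data.Product using (_×_; Σ-syntax; _,_; proj₁)
open import Relation.Binary.PropositionalEquality
open import Function using (_∘_)
open import Axiom.UniquenessOfIdentityProofs.WithK using (uip)

infixr 9 _∘ₕ_

_∘ₕ_ : ∀ {s d c ℓ i c₁ ℓ₁ c₂ ℓ₂ c₃ ℓ₃} {𝔸 : AQM s d c ℓ i}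
       {M : Module 𝔸 c₁ ℓ₁} {N : Module 𝔸 c₂ ℓ₂} {K : Module 𝔸 c₃ ℓ₃} →
       Hom N K → Hom M N → Hom M K
g ∘ₕ f = record
  { fun    = fun g ∘ fun f
  ; pres-⋁ = λ ne x → trans (cong (fun g) (Hom.pres-⋁ f ne x)) (Hom.pres-⋁ g ne _)
  ; pres-+ = λ x y → trans (cong (fun g) (Hom.pres-+ f x y)) (Hom.pres-+ g _ _)
  ; pres-𝟘 = trans (cong (fun g) (Hom.pres-𝟘 f)) (Hom.pres-𝟘 g)
  ; pres-∗ = λ a x → trans (cong (fun g) (Hom.pres-∗ f a x)) (Hom.pres-∗ g a _)
  }

module _ {s d c ℓ i c₁ ℓ₁} {𝔸 : AQM s d c ℓ i}
         (M : Module 𝔸 c₁ ℓ₁) (N : StructuralNucleus M) where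
  private
    module A = Quantale (AQM.𝐀 𝔸)
  open Quantale (Module.𝐐 M)
  open Module M using (∗-mono)
  open StructuralNucleus N
  open NucleusQuotient M N

  γ-≤ : ∀ {x y} → x ≤ γ y → γ x ≤ γ y
  γ-≤ {x} {y} x≤γy = ≤-trans (mono x≤γy) (subst (γ (γ y) ≤_) (idempotent y) ≤-refl)

  Fix-≡ : ∀ {p q : Fix} → proj₁ p ≡ proj₁ q → p ≡ q
  Fix-≡ {x , p} {.x , q} refl = cong (x ,_) (uip p q)

  ⌊⌋-cong : ∀ {x y} → x ≤ γ y → y ≤ γ x → ⌊ x ⌋ ≡ ⌊ y ⌋
  ⌊⌋-cong x≤γy y≤γx = Fix-≡ (≤-antisym (γ-≤ x≤γy) (γ-≤ y≤γx))

  ⌊⌋-hom : Hom M Moduleγ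
  ⌊⌋-hom = record
    { fun    = ⌊_⌋
    ; pres-⋁ = λ ne y → ⌊⌋-cong
        (≤-trans (⋁-least ne y _ (λ k → ≤-trans (expansive (y k)) (⋁-ub ne (γ ∘ y) k)))
                 (expansive _))
        (⋁-least ne (γ ∘ y) _ (λ k → mono (⋁-ub ne y k)))
    ; pres-+ = λ x y → ⌊⌋-cong
        (≤-trans (+-mono (expansive x) (expansive y)) (expansive _))
        (+-sub x y)
    ; pres-𝟘 = refl
    ; pres-∗ = λ a y → ⌊⌋-cong
        (≤-trans (∗-mono A.≤-refl (expansive y)) (expansive _))
        (∗-sub a y)
    }

  ⌊⌋-surjective : Surjective ⌊⌋-hom
  ⌊⌋-surjective (x , γx≡x) = x , Fix-≡ γx≡x

  lift-to-nucleus-quotient : ∀ {c₂ ℓ₂} {P : Module 𝔸 c₂ ℓ₂} → Projective P →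
                             (h : Hom P Moduleγ) →
                             Σ[ τ ∈ Hom P M ] (∀ x → fun h x ≡ ⌊ fun τ x ⌋)
  lift-to-nucleus-quotient projP h with projP M Moduleγ ⌊⌋-hom ⌊⌋-surjective h
  ... | τ , ⌊τ⌋≡h = τ , λ x → sym (⌊τ⌋≡h x)

corollary7p2 : ∀ {s : Setting} {d c ℓ i c₁ ℓ₁ c₂ ℓ₂ : Level} (𝔸 : AQM s d c ℓ i)
    (P : Module 𝔸 c₁ ℓ₁) (Q : Module 𝔸 c₂ ℓ₂) →
    Projective P → Projective Q →
    (γ : StructuralNucleus P) (δ : StructuralNucleus Q) →
    (f : Hom (NucleusQuotient.Moduleγ P γ) (NucleusQuotient.Moduleγ Q δ))
    (g : Hom (NucleusQuotient.Moduleγ Q δ) (NucleusQuotient.Moduleγ P γ)) →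
    (∀ y → fun f (fun g y) ≡ y) → (∀ x → fun g (fun f x) ≡ x) →
    Σ[ τ ∈ Hom P Q ] Σ[ ρ ∈ Hom Q P ]
    ((∀ x → fun f (NucleusQuotient.⌊_⌋ P γ x) ≡ NucleusQuotient.⌊_⌋ Q δ (fun τ x))
    × (∀ y → fun g (NucleusQuotient.⌊_⌋ Q δ y) ≡ NucleusQuotient.⌊_⌋ P γ (fun ρ y)))
corollary7p2 𝔸 P Q projP projQ γ δ f g _ _
  with lift-to-nucleus-quotient Q δ projP (f ∘ₕ ⌊⌋-hom P γ)
     | lift-to-nucleus-quotient P γ projQ (g ∘ₕ ⌊⌋-hom Q δ)
... | τ , fγ≡δτ | ρ , gδ≡γρ = τ , ρ , fγ≡δτ , gδ≡γρ
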